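{- Let $t$ be a positive integer, $s\ge 2$, and let $G=K(n_1,\dots,n_s)$ be a complete $s$-partite graph. If $n_j\ge 2t$ for every $j=1,\dots,s$, then $\chi_t(G)=s$.
   Context: $K(n_1,\dots,n_s)$ denotes the complete $s$-partite graph whose parts have $n_1,\dots,n_s$ vertices. A $t$-relaxed $k$-coloring of a graph is a map $f:V\to\{1,\dots,k\}$ such that every vertex $u$ has at most $t$ neighbors $v$ with $f(v)=f(u)$; $\chi_t(G)$ is the minimum $k$ for which such a coloring exists. -}

module Defs where

open import Data.Nat using (ℕ; zero; suc; _+_; _≤_; _<_)
open import Data.Fin using (Fin; zero; suc)
open import Data.Fin.Properties using (_≟_)
open import Data.Product using (Σ; _,_; ∃; _×_)
open import Relation.Nullary using (Dec; yes; no; ¬_)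
open import Relation.Binary.PropositionalEquality using (_≡_)

sumFin : (n : ℕ) → (Fin n → ℕ) → ℕ
sumFin zero    g = 0
sumFin (suc n) g = g zero + sumFin n (λ i → g (suc i))

ind : {P : Set} → Dec P → ℕ
ind (yes _) = 1
ind (no _)  = 0

-- Vertex set of the complete s-partite graph K(n_1,...,n_s):
-- a vertex is a pair (j , x) with j the part index and x ∈ Fin (n j).
Vertex : (s : ℕ) → (Fin s → ℕ) → Set
Vertex s n = Σ (Fin s) (λ j → Fin (n j))

Adj : {s : ℕ} {n : Fin s → ℕ} → Vertex s n → Vertex s n → Set
Adj (i , _) (j , _) = ¬ (i ≡ j)

sameColourNbr? : {s : ℕ} {n : Fin s → ℕ} {k : ℕ} →
                 (Vertex s n → Fin k) → Vertex s n → Vertex s n → ℕ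
sameColourNbr? f (j , x) (i , y) with i ≟ j
... | yes _ = 0
... | no  _ = ind (f (i , y) ≟ f (j , x))

sameColourNbrs : {s : ℕ} {n : Fin s → ℕ} {k : ℕ} →
                 (Vertex s n → Fin k) → Vertex s n → ℕ
sameColourNbrs {s} {n} f u =
  sumFin s (λ i → sumFin (n i) (λ y → sameColourNbr? f u (i , y)))

IsRelaxedColouring : (t s : ℕ) (n : Fin s → ℕ) (k : ℕ) →
                     (Vertex s n → Fin k) → Set
IsRelaxedColouring t s n k f = ∀ u → sameColourNbrs f u ≤ t

Colourable : (t s : ℕ) (n : Fin s → ℕ) (k : ℕ) → Set
Colourable t s n k = ∃ λ (f : Vertex s n → Fin k) → IsRelaxedColouring t s n k f

ChiT≡ : (t s : ℕ) (n : Fin s → ℕ) (m : ℕ) → Set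
ChiT≡ t s n m = Colourable t s n m × (∀ k → k < m → ¬ Colourable t s n k)

-- Colouring each vertex by its part is t-relaxed for every t, so χ_t ≤ s.  Conversely, let
-- f be a t-relaxed k-colouring and weigh the members of colour class c in part j by
-- min(2t, ·).  A class meeting part j has at most t vertices outside j, so its total weight
-- is at most 2t: either it has at most t vertices in j, or more than t, in which case no
-- other part can contain any of its vertices.  Every part has at least 2t vertices, so it
-- receives weight at least 2t from the classes.  Double counting gives 2t·s ≤ 2t·k.
module Submission where

open import Defs
open import Data.Nat using (ℕ; zero; suc; _+_; _*_; _⊓_; _≤_; _<_; z≤n; s≤s)
open import Data.Nat.Properties hiding (_≟_)
open import Data.Fin using (Fin; zero; suc; punchIn; punchOut)
open import Data.Fin.Properties using (_≟_; punchInᵢ≢i; punchIn-punchOut)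
open import Data.Vec.Functional using (removeAt)
open import Algebra.Properties.CommutativeMonoid.Sum +-0-commutativeMonoid
  using (sum; sum-remove; sum-cong-≗; sum-replicate-zero; ∑-comm)
open import Data.Product using (∃; _,_)
open import Data.Sum using (inj₁; inj₂)
open import Relation.Nullary using (Dec; yes; no; ¬_; contradiction)
open import Relation.Binary.PropositionalEquality
open import Function using (_∘_)

sumFin≡sum : ∀ n (g : Fin n → ℕ) → sumFin n g ≡ sum g
sumFin≡sum zero    g = refl
sumFin≡sum (suc n) g = cong (g zero +_) (sumFin≡sum n (g ∘ suc))

sum-const : ∀ n x → sum {n} (λ _ → x) ≡ n * x
sum-const zero    x = refl
sum-const (suc n) x = cong (x +_) (sum-const n x)

sum-zero : ∀ {n} {g : Fin n → ℕ} → (∀ i → g i ≡ 0) → sum g ≡ 0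
sum-zero {n} g≡0 = trans (sum-cong-≗ g≡0) (sum-replicate-zero n)

sum-mono-≤ : ∀ {n} {g h : Fin n → ℕ} → (∀ i → g i ≤ h i) → sum g ≤ sum h
sum-mono-≤ {zero}  g≤h = z≤n
sum-mono-≤ {suc n} g≤h = +-mono-≤ (g≤h zero) (sum-mono-≤ (g≤h ∘ suc))

term≤sum : ∀ {n} (g : Fin n → ℕ) i → g i ≤ sum g
term≤sum {suc n} g i = ≤-trans (m≤m+n (g i) _) (≤-reflexive (sym (sum-remove {i = i} g)))

term≤sum-removeAt : ∀ {n} (g : Fin (suc n) → ℕ) {i j} → i ≢ j → g j ≤ sum (removeAt g i)
term≤sum-removeAt g i≢j =
  subst (λ j → g j ≤ _) (punchIn-punchOut i≢j) (term≤sum (removeAt g _) (punchOut i≢j))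

sum-pos⇒term-pos : ∀ {n} (g : Fin n → ℕ) → 0 < sum g → ∃ λ i → 0 < g i
sum-pos⇒term-pos {suc n} g pos with g zero in eq
... | suc _ = zero , subst (0 <_) (sym eq) (s≤s z≤n)
... | zero  with sum-pos⇒term-pos (g ∘ suc) pos
...   | i , gi>0 = suc i , gi>0

⊓-subadditive : ∀ m a b → m ⊓ (a + b) ≤ m ⊓ a + m ⊓ b
⊓-subadditive m a b with ⊓-sel m a | ⊓-sel m b
... | inj₁ m⊓a≡m | _ =
  ≤-trans (m⊓n≤m m _) (≤-trans (≤-reflexive (sym m⊓a≡m)) (m≤m+n _ _))
... | inj₂ _ | inj₁ m⊓b≡m =
  ≤-trans (m⊓n≤m m _) (≤-trans (≤-reflexive (sym m⊓b≡m)) (m≤n+m _ _))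
... | inj₂ m⊓a≡a | inj₂ m⊓b≡b =
  ≤-trans (m⊓n≤n m _) (≤-reflexive (sym (cong₂ _+_ m⊓a≡a m⊓b≡b)))

⊓-sum-≤ : ∀ m {n} (g : Fin n → ℕ) → m ⊓ sum g ≤ sum (λ i → m ⊓ g i)
⊓-sum-≤ m {zero}  g = ≤-reflexive (⊓-zeroʳ m)
⊓-sum-≤ m {suc n} g =
  ≤-trans (⊓-subadditive m (g zero) _) (+-monoʳ-≤ (m ⊓ g zero) (⊓-sum-≤ m (g ∘ suc)))

ind-yes : ∀ {P : Set} (p : Dec P) → P → ind p ≡ 1
ind-yes (yes _) _  = refl
ind-yes (no ¬P) P  = contradiction P ¬P

ind-no : ∀ {P : Set} (p : Dec P) → ¬ P → ind p ≡ 0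
ind-no (yes P) ¬P = contradiction P ¬P
ind-no (no _)  _  = refl

ind-pos : ∀ {P : Set} (p : Dec P) → 0 < ind p → P
ind-pos (yes P) _ = P

sum-indicator : ∀ {k} (d : Fin k) → sum (λ c → ind (d ≟ c)) ≡ 1
sum-indicator {suc k} d = begin
  sum (λ c → ind (d ≟ c))                                    ≡⟨ sum-remove {i = d} (λ c → ind (d ≟ c)) ⟩
  ind (d ≟ d) + sum (λ c → ind (d ≟ punchIn d c))            ≡⟨ cong₂ _+_ (ind-yes (d ≟ d) refl)
                                                                 (sum-zero (λ c → ind-no _ (punchInᵢ≢i d c ∘ sym))) ⟩
  1                                                          ∎
  where open ≡-Reasoning

-- g j plays the role of the number of vertices of a colour class in part j.
Clustered : ℕ → ∀ {m} → (Fin (suc m) → ℕ) → Set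
Clustered t g = ∀ j → 0 < g j → sum (removeAt g j) ≤ t

clustered⇒sum-⊓≤ : ∀ t {m} (g : Fin (suc m) → ℕ) → Clustered t g → sum (λ i → 2 * t ⊓ g i) ≤ 2 * t
clustered⇒sum-⊓≤ t {m} g clustered with 0 <? sum g
... | no  ¬pos = ≤-trans (sum-mono-≤ (λ i → m⊓n≤n (2 * t) (g i))) (≤-trans (≮⇒≥ ¬pos) z≤n)
... | yes pos  with sum-pos⇒term-pos g pos
...   | j , gj>0 = begin
  sum h                         ≡⟨ sum-remove {i = j} h ⟩
  h j + sum (removeAt h j)      ≤⟨ +-monoʳ-≤ (h j) (sum-mono-≤ (λ i → m⊓n≤n (2 * t) (removeAt g j i))) ⟩
  h j + sum (removeAt g j)      ≤⟨ weight-bound (g j ≤? t) ⟩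
  2 * t                         ∎
  where
  open ≤-Reasoning
  h : Fin (suc m) → ℕ
  h i = 2 * t ⊓ g i

  outside-empty : ¬ g j ≤ t → ∀ i → removeAt g j i ≡ 0
  outside-empty gj≰t i with 0 <? removeAt g j i
  ... | no ¬pos = n≤0⇒n≡0 (≮⇒≥ ¬pos)
  ... | yes pos = contradiction
    (≤-trans (term≤sum-removeAt g (punchInᵢ≢i j i)) (clustered (punchIn j i) pos)) gj≰t

  weight-bound : Dec (g j ≤ t) → h j + sum (removeAt g j) ≤ 2 * t
  weight-bound (yes gj≤t) =
    ≤-trans (+-mono-≤ (≤-trans (m⊓n≤n _ (g j)) gj≤t) (clustered j gj>0))
            (≤-reflexive (cong (t +_) (sym (+-identityʳ t))))
  weight-bound (no gj≰t) rewrite sum-zero (outside-empty gj≰t) =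
    ≤-trans (≤-reflexive (+-identityʳ (h j))) (m⊓n≤m (2 * t) (g j))

module _ {s} {n : Fin s → ℕ} {k} (f : Vertex s n → Fin k) where

  colourCount : Fin k → Fin s → ℕ
  colourCount c i = sum (λ y → ind (f (i , y) ≟ c))

  sum-colourCount : ∀ i → sum (λ c → colourCount c i) ≡ n i
  sum-colourCount i = begin
    sum (λ c → sum (λ y → ind (f (i , y) ≟ c)))  ≡⟨ ∑-comm (λ y c → ind (f (i , y) ≟ c)) ⟨
    sum (λ y → sum (λ c → ind (f (i , y) ≟ c)))  ≡⟨ sum-cong-≗ (λ y → sum-indicator (f (i , y))) ⟩
    sum {n i} (λ _ → 1)                          ≡⟨ sum-const (n i) 1 ⟩
    n i * 1                                      ≡⟨ *-identityʳ (n i) ⟩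
    n i                                          ∎
    where open ≡-Reasoning

  colourCount-pos : ∀ {c i} → 0 < colourCount c i → ∃ λ y → f (i , y) ≡ c
  colourCount-pos {c} {i} pos with sum-pos⇒term-pos _ pos
  ... | y , indicator>0 = y , ind-pos (f (i , y) ≟ c) indicator>0

  ≤-sum-⊓-colourCount : ∀ {M} i → M ≤ n i → M ≤ sum (λ c → M ⊓ colourCount c i)
  ≤-sum-⊓-colourCount {M} i M≤ni = begin
    M                                    ≡⟨ m≤n⇒m⊓n≡m M≤ni ⟨
    M ⊓ n i                              ≡⟨ cong (M ⊓_) (sum-colourCount i) ⟨
    M ⊓ sum (λ c → colourCount c i)      ≤⟨ ⊓-sum-≤ M (λ c → colourCount c i) ⟩
    sum (λ c → M ⊓ colourCount c i)      ∎
    where open ≤-Reasoning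

  sameColourNbrs≡sum : ∀ u → sameColourNbrs f u ≡ sum (λ i → sum (λ y → sameColourNbr? f u (i , y)))
  sameColourNbrs≡sum u =
    trans (sumFin≡sum s _) (sum-cong-≗ (λ i → sumFin≡sum (n i) _))

  sameColourNbr?-samePart : ∀ j x y → sameColourNbr? f (j , x) (j , y) ≡ 0
  sameColourNbr?-samePart j x y with j ≟ j
  ... | yes _   = refl
  ... | no j≢j  = contradiction refl j≢j

  sameColourNbr?-otherPart : ∀ {i j} x y → i ≢ j →
                             sameColourNbr? f (j , x) (i , y) ≡ ind (f (i , y) ≟ f (j , x))
  sameColourNbr?-otherPart {i} {j} x y i≢j with i ≟ j
  ... | yes i≡j = contradiction i≡j i≢j
  ... | no _    = refl

module _ {m} {n : Fin (suc m) → ℕ} {k} (f : Vertex (suc m) n → Fin k) where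

  sameColourNbrs≡outsideCount : ∀ j x →
    sameColourNbrs f (j , x) ≡ sum (removeAt (colourCount f (f (j , x))) j)
  sameColourNbrs≡outsideCount j x = begin
    sameColourNbrs f (j , x)                   ≡⟨ sameColourNbrs≡sum f (j , x) ⟩
    sum nbrsIn                                 ≡⟨ sum-remove {i = j} nbrsIn ⟩
    nbrsIn j + sum (removeAt nbrsIn j)         ≡⟨ cong₂ _+_ (sum-zero (sameColourNbr?-samePart f j x))
                                                     (sum-cong-≗ (λ i → sum-cong-≗
                                                       (λ y → sameColourNbr?-otherPart f x y (punchInᵢ≢i j i)))) ⟩
    sum (removeAt (colourCount f (f (j , x))) j) ∎
    where
    open ≡-Reasoning
    nbrsIn : Fin (suc m) → ℕ
    nbrsIn i = sum (λ y → sameColourNbr? f (j , x) (i , y))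

  relaxed⇒clustered : ∀ {t} → IsRelaxedColouring t (suc m) n k f → ∀ c → Clustered t (colourCount f c)
  relaxed⇒clustered {t} relaxed c j pos with colourCount-pos f pos
  ... | y , refl = subst (_≤ t) (sameColourNbrs≡outsideCount j y) (relaxed (j , y))

colourable⇒parts≤colours : ∀ {t s} {n : Fin s → ℕ} {k} → 1 ≤ t → (∀ j → 2 * t ≤ n j) →
                           Colourable t s n k → s ≤ k
colourable⇒parts≤colours {s = zero} _ _ _ = z≤n
colourable⇒parts≤colours {t@(suc _)} {suc m} {n} {k} _ large (f , relaxed) =
  *-cancelʳ-≤ (suc m) k (2 * t) (begin
    suc m * (2 * t)                                    ≡⟨ sum-const (suc m) (2 * t) ⟨
    sum {suc m} (λ _ → 2 * t)                          ≤⟨ sum-mono-≤ (λ j → ≤-sum-⊓-colourCount f j (large j)) ⟩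
    sum (λ j → sum (λ c → 2 * t ⊓ colourCount f c j))  ≡⟨ ∑-comm (λ j c → 2 * t ⊓ colourCount f c j) ⟩
    sum (λ c → sum (λ j → 2 * t ⊓ colourCount f c j))  ≤⟨ sum-mono-≤ classWeight≤ ⟩
    sum {k} (λ _ → 2 * t)                              ≡⟨ sum-const k (2 * t) ⟩
    k * (2 * t)                                        ∎)
  where
  open ≤-Reasoning
  classWeight≤ : ∀ c → sum (λ j → 2 * t ⊓ colourCount f c j) ≤ 2 * t
  classWeight≤ c = clustered⇒sum-⊓≤ t (colourCount f c) (relaxed⇒clustered f relaxed c)

partColouring : ∀ {s} (n : Fin s → ℕ) → Vertex s n → Fin s
partColouring n (j , _) = j

partColouring-relaxed : ∀ t s (n : Fin s → ℕ) → IsRelaxedColouring t s n s (partColouring n)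
partColouring-relaxed t s n u =
  subst (_≤ t) (sym (trans (sameColourNbrs≡sum f u) (sum-zero (λ i → sum-zero (λ y → noSameColourNbr u (i , y))))))
        z≤n
  where
  f = partColouring n
  noSameColourNbr : ∀ u v → sameColourNbr? f u v ≡ 0
  noSameColourNbr (j , x) (i , y) with i ≟ j
  ... | yes _   = refl
  ... | no i≢j  = ind-no (i ≟ j) i≢j

corollary2p3 : (t s : ℕ) (n : Fin s → ℕ) → 1 ≤ t → 2 ≤ s →
    (∀ j → 2 * t ≤ n j) → ChiT≡ t s n s
corollary2p3 t s n 1≤t _ large =
    (partColouring n , partColouring-relaxed t s n)
  , λ k k<s colourable → <⇒≱ k<s (colourable⇒parts≤colours 1≤t large colourable)
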